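{- Let $\mathfrak G=(X,\preceq,\sqsubset,P)$ be a general $\rightsquigarrow$-frame and let $\hat\sigma P$ be the Boolean closure of $P$ in the powerset of $X$. Then $\hat\sigma\mathfrak G=(X,\preceq,\sqsubset,\hat\sigma P)$ is a general $\mathsf{S4BHL}$-frame (with $R_i={\preceq}$, $R_m={\sqsubset}$). Moreover, $[m]a\in P$ for every $a\in\hat\sigma P$.
   Context: A $\rightsquigarrow$-frame is $(X,\preceq,\sqsubset)$ with $\preceq$ a partial order and $\sqsubset$ a relation such that $x\preceq y\sqsubset z$ implies $x\sqsubset z$. For upsets $a,b$: $a\underline{\to}b=\{x:\forall y(x\preceq y,y\in a\Rightarrow y\in b)\}$, $a\underline{\rightsquigarrow}b=\{x:\forall y(x\sqsubset y,y\in a\Rightarrow y\in b)\}$. A general $\rightsquigarrow$-frame $(X,\preceq,\sqsubset,P)$ has $P$ a family of $\preceq$-upsets containing $X,\emptyset$, closed under $\cap,\cup,\underline{\to},\underline{\rightsquigarrow}$. An $\mathsf{S4K}$-frame is $(X,R_i,R_m)$ with $R_i$ a preorder and $R_m$ any binary relation on $X$; for $a\subseteq X$, $[i]a=\{x:\forall y(xR_iy\Rightarrow y\in a)\}$ and $[m]a=\{x:\forall y(xR_my\Rightarrow y\in a)\}$. A general $\mathsf{S4K}$-frame $(X,R_i,R_m,P)$ has $P$ a Boolean subalgebra of the powerset of $X$ closed under $[i]$ and $[m]$. It is a general $\mathsf{S4BHL}$-frame if moreover $xR_iyR_mz$ implies $xR_mz$. -}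

module Defs where

open import Level using (0ℓ)
open import Data.Product using (Σ; _×_; _,_)
open import Data.Sum using (_⊎_)
open import Data.Empty using (⊥)
open import Data.Unit using (⊤)
open import Relation.Nullary using (¬_)
open import Relation.Binary.PropositionalEquality using (_≡_)
open import Relation.Binary.Structures using (IsPartialOrder; IsPreorder)

Subset : Set → Set₁
Subset X = X → Set

Family : Set → Set₂
Family X = Subset X → Set₁

module _ {X : Set} where

  _≐_ : Subset X → Subset X → Set
  a ≐ b = (∀ x → a x → b x) × (∀ x → b x → a x)

  -- membership of a subset in a family, up to extensional equality
  -- (subsets with the same elements are equal, as in set theory)
  _∈ₛ_ : Subset X → Family X → Set₁
  a ∈ₛ F = Σ (Subset X) λ b → F b × (b ≐ a)

  ∅ₛ : Subset X
  ∅ₛ _ = ⊥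

  Uₛ : Subset X
  Uₛ _ = ⊤

  _∩ₛ_ : Subset X → Subset X → Subset X
  (a ∩ₛ b) x = a x × b x

  _∪ₛ_ : Subset X → Subset X → Subset X
  (a ∪ₛ b) x = a x ⊎ b x

  ∁ₛ : Subset X → Subset X
  ∁ₛ a x = ¬ a x

  Arrow : (X → X → Set) → Subset X → Subset X → Subset X
  Arrow R a b x = ∀ y → R x y → a y → b y

  Box : (X → X → Set) → Subset X → Subset X
  Box R a x = ∀ y → R x y → a y

  IsUpset : (X → X → Set) → Subset X → Set
  IsUpset _≼_ a = ∀ x y → x ≼ y → a x → a y

  data BoolClosure (P : Family X) : Family X where
    base  : ∀ {a} → P a → BoolClosure P a
    empty : BoolClosure P ∅ₛ
    full  : BoolClosure P Uₛ
    compl : ∀ {a} → BoolClosure P a → BoolClosure P (∁ₛ a)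
    inter : ∀ {a b} → BoolClosure P a → BoolClosure P b → BoolClosure P (a ∩ₛ b)
    union : ∀ {a b} → BoolClosure P a → BoolClosure P b → BoolClosure P (a ∪ₛ b)

record IsGeneralSqFrame (X : Set) (_≼_ _⊏_ : X → X → Set) (P : Family X) : Set₂ where
  field
    partialOrder : IsPartialOrder _≡_ _≼_
    compat       : ∀ {x y z} → x ≼ y → y ⊏ z → x ⊏ z
    upsets       : ∀ a → P a → IsUpset _≼_ a
    has-full     : Uₛ ∈ₛ P
    has-empty    : ∅ₛ ∈ₛ P
    closed-∩     : ∀ a b → a ∈ₛ P → b ∈ₛ P → (a ∩ₛ b) ∈ₛ P
    closed-∪     : ∀ a b → a ∈ₛ P → b ∈ₛ P → (a ∪ₛ b) ∈ₛ P
    closed-→     : ∀ a b → a ∈ₛ P → b ∈ₛ P → Arrow _≼_ a b ∈ₛ P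
    closed-⇝     : ∀ a b → a ∈ₛ P → b ∈ₛ P → Arrow _⊏_ a b ∈ₛ P

record IsGeneralS4KFrame (X : Set) (Ri Rm : X → X → Set) (Q : Family X) : Set₂ where
  field
    preorder  : IsPreorder _≡_ Ri
    has-full  : Uₛ ∈ₛ Q
    has-empty : ∅ₛ ∈ₛ Q
    closed-∁  : ∀ a → a ∈ₛ Q → ∁ₛ a ∈ₛ Q
    closed-∩  : ∀ a b → a ∈ₛ Q → b ∈ₛ Q → (a ∩ₛ b) ∈ₛ Q
    closed-∪  : ∀ a b → a ∈ₛ Q → b ∈ₛ Q → (a ∪ₛ b) ∈ₛ Q
    closed-[i] : ∀ a → a ∈ₛ Q → Box Ri a ∈ₛ Q
    closed-[m] : ∀ a → a ∈ₛ Q → Box Rm a ∈ₛ Q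

record IsGeneralS4BHLFrame (X : Set) (Ri Rm : X → X → Set) (Q : Family X) : Set₂ where
  field
    s4k : IsGeneralS4KFrame X Ri Rm Q
    bhl : ∀ {x y z} → Ri x y → Rm y z → Rm x z

-- Classically, the Boolean closure of a bounded lattice of sets P consists of
-- finite intersections of clauses a ⇒ b = ∁a ∪ b with a, b ∈ P: such meets
-- contain P and the complements of members of P, and are closed under ∩ and
-- (by distributivity and (a ⇒ b) ∪ (a' ⇒ b') = (a ∩ a') ⇒ (b ∪ b')) under ∪.
-- A box [R] distributes over intersections and sends a clause a ⇒ b to the
-- arrow a →R b, so [R] maps such meets into P whenever P is closed under →R.
-- This gives closure under [i] and [m] (the latter landing already in P);
-- the remaining frame condition is the compatibility x ≼ y ⊏ z ⇒ x ⊏ z.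
module Submission where

open import Defs
open import Level using (0ℓ)
open import Function using (_∘_)
open import Data.Product using (_×_; _,_; proj₁; proj₂)
open import Data.Sum using (inj₁; inj₂)
open import Data.Empty using (⊥-elim)
open import Data.Unit using (tt)
open import Relation.Nullary using (yes; no)
open import Relation.Binary.Structures using (IsPartialOrder)
open import Axiom.ExcludedMiddle using (ExcludedMiddle)

module _ {X : Set} where

  ≐-refl : {a : Subset X} → a ≐ a
  ≐-refl = (λ _ ax → ax) , (λ _ ax → ax)

  ≐-sym : {a b : Subset X} → a ≐ b → b ≐ a
  ≐-sym (a⊆b , b⊆a) = b⊆a , a⊆b

  ≐-trans : {a b c : Subset X} → a ≐ b → b ≐ c → a ≐ c
  ≐-trans (a⊆b , b⊆a) (b⊆c , c⊆b) =
    (λ x ax → b⊆c x (a⊆b x ax)) , (λ x cx → b⊆a x (c⊆b x cx))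

  ∈ₛ-intro : {F : Family X} {a : Subset X} → F a → a ∈ₛ F
  ∈ₛ-intro Fa = _ , Fa , ≐-refl

  ∈ₛ-resp-≐ : {F : Family X} {a b : Subset X} → a ∈ₛ F → a ≐ b → b ∈ₛ F
  ∈ₛ-resp-≐ (c , Fc , c≐a) a≐b = c , Fc , ≐-trans c≐a a≐b

  ∈ₛ-mono : {F G : Family X} → (∀ {a} → F a → G a) → ∀ {a} → a ∈ₛ F → a ∈ₛ G
  ∈ₛ-mono F⊆G (b , Fb , b≐a) = b , F⊆G Fb , b≐a

  ∈ₛ-bind : {F G : Family X} → (∀ {a} → F a → a ∈ₛ G) → ∀ {a} → a ∈ₛ F → a ∈ₛ G
  ∈ₛ-bind F⊆G (b , Fb , b≐a) = ∈ₛ-resp-≐ (F⊆G Fb) b≐a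

  ∈ₛ-map₁ : {F G : Family X} (f : Subset X → Subset X) →
    (∀ {a b} → a ≐ b → f a ≐ f b) → (∀ {a} → F a → f a ∈ₛ G) →
    ∀ {a} → a ∈ₛ F → f a ∈ₛ G
  ∈ₛ-map₁ f f-cong closed (b , Fb , b≐a) = ∈ₛ-resp-≐ (closed Fb) (f-cong b≐a)

  ∈ₛ-map₂ : {F : Family X} (f : Subset X → Subset X → Subset X) →
    (∀ {a a' b b'} → a ≐ a' → b ≐ b' → f a b ≐ f a' b') →
    (∀ {a b} → F a → F b → f a b ∈ₛ F) →
    ∀ {a b} → a ∈ₛ F → b ∈ₛ F → f a b ∈ₛ F
  ∈ₛ-map₂ f f-cong closed (a' , Fa' , a'≐a) (b' , Fb' , b'≐b) =
    ∈ₛ-resp-≐ (closed Fa' Fb') (f-cong a'≐a b'≐b)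

  ∁-cong : {a b : Subset X} → a ≐ b → ∁ₛ a ≐ ∁ₛ b
  ∁-cong (a⊆b , b⊆a) = (λ x ¬ax bx → ¬ax (b⊆a x bx)) , (λ x ¬bx ax → ¬bx (a⊆b x ax))

  ∩-cong : {a a' b b' : Subset X} → a ≐ a' → b ≐ b' → (a ∩ₛ b) ≐ (a' ∩ₛ b')
  ∩-cong (a⊆a' , a'⊆a) (b⊆b' , b'⊆b) =
    (λ x (ax , bx) → a⊆a' x ax , b⊆b' x bx) , (λ x (ax , bx) → a'⊆a x ax , b'⊆b x bx)

  ∪-cong : {a a' b b' : Subset X} → a ≐ a' → b ≐ b' → (a ∪ₛ b) ≐ (a' ∪ₛ b')
  ∪-cong (a⊆a' , a'⊆a) (b⊆b' , b'⊆b) =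
    (λ { x (inj₁ ax) → inj₁ (a⊆a' x ax) ; x (inj₂ bx) → inj₂ (b⊆b' x bx) }) ,
    (λ { x (inj₁ ax) → inj₁ (a'⊆a x ax) ; x (inj₂ bx) → inj₂ (b'⊆b x bx) })

  Box-cong : {R : X → X → Set} {a b : Subset X} → a ≐ b → Box R a ≐ Box R b
  Box-cong (a⊆b , b⊆a) = (λ x □a y xRy → a⊆b y (□a y xRy)) , (λ x □b y xRy → b⊆a y (□b y xRy))

  ∩-assoc : {a b c : Subset X} → ((a ∩ₛ b) ∩ₛ c) ≐ (a ∩ₛ (b ∩ₛ c))
  ∩-assoc = (λ x ((ax , bx) , cx) → ax , bx , cx) , (λ x (ax , bx , cx) → (ax , bx) , cx)

  ∩-identityˡ : {a : Subset X} → (Uₛ ∩ₛ a) ≐ a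
  ∩-identityˡ = (λ _ → proj₂) , (λ _ ax → tt , ax)

  ∩-identityʳ : {a : Subset X} → (a ∩ₛ Uₛ) ≐ a
  ∩-identityʳ = (λ _ → proj₁) , (λ _ ax → ax , tt)

  ∪-zeroˡ : {a : Subset X} → (Uₛ ∪ₛ a) ≐ Uₛ
  ∪-zeroˡ = (λ _ _ → tt) , (λ _ _ → inj₁ tt)

  ∪-zeroʳ : {a : Subset X} → (a ∪ₛ Uₛ) ≐ Uₛ
  ∪-zeroʳ = (λ _ _ → tt) , (λ _ _ → inj₂ tt)

  ∪-distribˡ-∩ : {a b c : Subset X} → (a ∪ₛ (b ∩ₛ c)) ≐ ((a ∪ₛ b) ∩ₛ (a ∪ₛ c))
  ∪-distribˡ-∩ =
    (λ { x (inj₁ ax) → inj₁ ax , inj₁ ax ; x (inj₂ (bx , cx)) → inj₂ bx , inj₂ cx }) ,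
    (λ { x (inj₁ ax , _) → inj₁ ax ; x (inj₂ _ , inj₁ ax) → inj₁ ax
       ; x (inj₂ bx , inj₂ cx) → inj₂ (bx , cx) })

  ∪-distribʳ-∩ : {a b c : Subset X} → ((a ∩ₛ b) ∪ₛ c) ≐ ((a ∪ₛ c) ∩ₛ (b ∪ₛ c))
  ∪-distribʳ-∩ =
    (λ { x (inj₁ (ax , bx)) → inj₁ ax , inj₁ bx ; x (inj₂ cx) → inj₂ cx , inj₂ cx }) ,
    (λ { x (inj₂ cx , _) → inj₂ cx ; x (inj₁ _ , inj₂ cx) → inj₂ cx
       ; x (inj₁ ax , inj₁ bx) → inj₁ (ax , bx) })

  ∁-∪ : {a b : Subset X} → ∁ₛ (a ∪ₛ b) ≐ (∁ₛ a ∩ₛ ∁ₛ b)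
  ∁-∪ = (λ x ¬a∪b → ¬a∪b ∘ inj₁ , ¬a∪b ∘ inj₂) ,
        (λ { x (¬ax , ¬bx) (inj₁ ax) → ¬ax ax ; x (¬ax , ¬bx) (inj₂ bx) → ¬bx bx })

  Box-Uₛ : {R : X → X → Set} → Box R Uₛ ≐ Uₛ
  Box-Uₛ = (λ _ _ → tt) , (λ _ _ _ _ → tt)

  Box-∩ : {R : X → X → Set} {a b : Subset X} → Box R (a ∩ₛ b) ≐ (Box R a ∩ₛ Box R b)
  Box-∩ = (λ x □ab → (λ y xRy → proj₁ (□ab y xRy)) , (λ y xRy → proj₂ (□ab y xRy))) ,
          (λ x (□a , □b) y xRy → □a y xRy , □b y xRy)

  -- Pointwise implication, i.e. ∁a ∪ b classically.  It is chosen over ∁a ∪ b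
  -- because Box R (a ⇒ₛ b) is then definitionally Arrow R a b, and ∁ₛ a is
  -- definitionally a ⇒ₛ ∅ₛ.
  _⇒ₛ_ : Subset X → Subset X → Subset X
  (a ⇒ₛ b) x = a x → b x

  ⇒-identityˡ : {a : Subset X} → (Uₛ ⇒ₛ a) ≐ a
  ⇒-identityˡ = (λ _ ⊤→a → ⊤→a tt) , (λ _ ax _ → ax)

module Classical (lem : ExcludedMiddle 0ℓ) {X : Set} where

  ∁-involutive : {a : Subset X} → ∁ₛ (∁ₛ a) ≐ a
  ∁-involutive {a} = ¬¬a⇒a , (λ x ax ¬ax → ¬ax ax)
    where
    ¬¬a⇒a : ∀ x → ∁ₛ (∁ₛ a) x → a x
    ¬¬a⇒a x ¬¬ax with lem {a x}
    ... | yes ax = ax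
    ... | no ¬ax = ⊥-elim (¬¬ax ¬ax)

  ∁-∩ : {a b : Subset X} → ∁ₛ (a ∩ₛ b) ≐ (∁ₛ a ∪ₛ ∁ₛ b)
  ∁-∩ {a} {b} = ¬a∩b⇒ , (λ { x (inj₁ ¬ax) (ax , _) → ¬ax ax ; x (inj₂ ¬bx) (_ , bx) → ¬bx bx })
    where
    ¬a∩b⇒ : ∀ x → ∁ₛ (a ∩ₛ b) x → (∁ₛ a ∪ₛ ∁ₛ b) x
    ¬a∩b⇒ x ¬abx with lem {a x}
    ... | yes ax = inj₂ (λ bx → ¬abx (ax , bx))
    ... | no ¬ax = inj₁ ¬ax

  ⇒-∪-⇒ : {a b a' b' : Subset X} → ((a ⇒ₛ b) ∪ₛ (a' ⇒ₛ b')) ≐ ((a ∩ₛ a') ⇒ₛ (b ∪ₛ b'))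
  ⇒-∪-⇒ {a} {b} {a'} {b'} =
    (λ { x (inj₁ a⇒b) (ax , _) → inj₁ (a⇒b ax) ; x (inj₂ a'⇒b') (_ , a'x) → inj₂ (a'⇒b' a'x) }) ,
    split
    where
    split : ∀ x → ((a ∩ₛ a') ⇒ₛ (b ∪ₛ b')) x → ((a ⇒ₛ b) ∪ₛ (a' ⇒ₛ b')) x
    split x aa'⇒bb' with lem {a x} | lem {a' x}
    ... | no ¬ax | _ = inj₁ (⊥-elim ∘ ¬ax)
    ... | yes _ | no ¬a'x = inj₂ (⊥-elim ∘ ¬a'x)
    ... | yes ax | yes a'x with aa'⇒bb' (ax , a'x)
    ...   | inj₁ bx = inj₁ (λ _ → bx)
    ...   | inj₂ b'x = inj₂ (λ _ → b'x)

module ClauseMeets (lem : ExcludedMiddle 0ℓ) {X : Set} (P : Family X)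
  (has-full : Uₛ ∈ₛ P) (has-empty : ∅ₛ ∈ₛ P)
  (closed-∩ : ∀ a b → a ∈ₛ P → b ∈ₛ P → (a ∩ₛ b) ∈ₛ P)
  (closed-∪ : ∀ a b → a ∈ₛ P → b ∈ₛ P → (a ∪ₛ b) ∈ₛ P) where

  open Classical lem

  data ClauseMeet : Family X where
    ⊤-meet : ClauseMeet Uₛ
    ⇒-∩-meet : ∀ {a b c} → a ∈ₛ P → b ∈ₛ P → ClauseMeet c → ClauseMeet ((a ⇒ₛ b) ∩ₛ c)

  clause∈ : ∀ {a b} → a ∈ₛ P → b ∈ₛ P → (a ⇒ₛ b) ∈ₛ ClauseMeet
  clause∈ a∈P b∈P = _ , ⇒-∩-meet a∈P b∈P ⊤-meet , ∩-identityʳ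

  P⊆ClauseMeet : ∀ {a} → a ∈ₛ P → a ∈ₛ ClauseMeet
  P⊆ClauseMeet a∈P = ∈ₛ-resp-≐ (clause∈ has-full a∈P) ⇒-identityˡ

  ∩-meet : ∀ {c d} → ClauseMeet c → ClauseMeet d → (c ∩ₛ d) ∈ₛ ClauseMeet
  ∩-meet ⊤-meet md = ∈ₛ-resp-≐ (∈ₛ-intro md) (≐-sym ∩-identityˡ)
  ∩-meet (⇒-∩-meet {a} {b} a∈P b∈P mc) md =
    ∈ₛ-resp-≐ (∈ₛ-map₁ ((a ⇒ₛ b) ∩ₛ_) (∩-cong ≐-refl) (∈ₛ-intro ∘ ⇒-∩-meet a∈P b∈P) (∩-meet mc md))
              (≐-sym ∩-assoc)

  ∩-∈ₛ : ∀ {c d} → c ∈ₛ ClauseMeet → d ∈ₛ ClauseMeet → (c ∩ₛ d) ∈ₛ ClauseMeet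
  ∩-∈ₛ = ∈ₛ-map₂ _∩ₛ_ ∩-cong ∩-meet

  clause-∪-meet : ∀ {a b d} → a ∈ₛ P → b ∈ₛ P → ClauseMeet d → ((a ⇒ₛ b) ∪ₛ d) ∈ₛ ClauseMeet
  clause-∪-meet a∈P b∈P ⊤-meet = ∈ₛ-resp-≐ (∈ₛ-intro ⊤-meet) (≐-sym ∪-zeroʳ)
  clause-∪-meet a∈P b∈P (⇒-∩-meet a'∈P b'∈P md) =
    ∈ₛ-resp-≐ (∩-∈ₛ (∈ₛ-resp-≐ (clause∈ (closed-∩ _ _ a∈P a'∈P) (closed-∪ _ _ b∈P b'∈P)) (≐-sym ⇒-∪-⇒))
                    (clause-∪-meet a∈P b∈P md))
              (≐-sym ∪-distribˡ-∩)

  ∪-meet : ∀ {c d} → ClauseMeet c → ClauseMeet d → (c ∪ₛ d) ∈ₛ ClauseMeet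
  ∪-meet ⊤-meet md = ∈ₛ-resp-≐ (∈ₛ-intro ⊤-meet) (≐-sym ∪-zeroˡ)
  ∪-meet (⇒-∩-meet a∈P b∈P mc) md =
    ∈ₛ-resp-≐ (∩-∈ₛ (clause-∪-meet a∈P b∈P md) (∪-meet mc md)) (≐-sym ∪-distribʳ-∩)

  ∪-∈ₛ : ∀ {c d} → c ∈ₛ ClauseMeet → d ∈ₛ ClauseMeet → (c ∪ₛ d) ∈ₛ ClauseMeet
  ∪-∈ₛ = ∈ₛ-map₂ _∪ₛ_ ∪-cong ∪-meet

  -- Carrying ∁c along avoids a separate complement operation on meets.
  BoolClosure⊆ClauseMeet : ∀ {c} → BoolClosure P c → c ∈ₛ ClauseMeet × ∁ₛ c ∈ₛ ClauseMeet
  BoolClosure⊆ClauseMeet (base c∈P) = P⊆ClauseMeet (∈ₛ-intro c∈P) , clause∈ (∈ₛ-intro c∈P) has-empty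
  BoolClosure⊆ClauseMeet empty = P⊆ClauseMeet has-empty , clause∈ has-empty has-empty
  BoolClosure⊆ClauseMeet full = ∈ₛ-intro ⊤-meet , clause∈ has-full has-empty
  BoolClosure⊆ClauseMeet (compl bc) with BoolClosure⊆ClauseMeet bc
  ... | c∈ , ∁c∈ = ∁c∈ , ∈ₛ-resp-≐ c∈ (≐-sym ∁-involutive)
  BoolClosure⊆ClauseMeet (inter bc bd) with BoolClosure⊆ClauseMeet bc | BoolClosure⊆ClauseMeet bd
  ... | c∈ , ∁c∈ | d∈ , ∁d∈ = ∩-∈ₛ c∈ d∈ , ∈ₛ-resp-≐ (∪-∈ₛ ∁c∈ ∁d∈) (≐-sym ∁-∩)
  BoolClosure⊆ClauseMeet (union bc bd) with BoolClosure⊆ClauseMeet bc | BoolClosure⊆ClauseMeet bd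
  ... | c∈ , ∁c∈ | d∈ , ∁d∈ = ∪-∈ₛ c∈ d∈ , ∈ₛ-resp-≐ (∩-∈ₛ ∁c∈ ∁d∈) (≐-sym ∁-∪)

  module _ (R : X → X → Set) (closed-Arrow : ∀ a b → a ∈ₛ P → b ∈ₛ P → Arrow R a b ∈ₛ P) where

    Box-meet∈P : ∀ {c} → ClauseMeet c → Box R c ∈ₛ P
    Box-meet∈P ⊤-meet = ∈ₛ-resp-≐ has-full (≐-sym Box-Uₛ)
    Box-meet∈P (⇒-∩-meet a∈P b∈P mc) =
      ∈ₛ-resp-≐ (closed-∩ _ _ (closed-Arrow _ _ a∈P b∈P) (Box-meet∈P mc)) (≐-sym Box-∩)

    Box-BoolClosure∈P : ∀ {c} → c ∈ₛ BoolClosure P → Box R c ∈ₛ P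
    Box-BoolClosure∈P =
      ∈ₛ-map₁ (Box R) Box-cong Box-meet∈P ∘ ∈ₛ-bind (proj₁ ∘ BoolClosure⊆ClauseMeet)

lemma4p5 : ExcludedMiddle 0ℓ →
    (X : Set) (_≼_ _⊏_ : X → X → Set) (P : Family X) →
    IsGeneralSqFrame X _≼_ _⊏_ P →
    IsGeneralS4BHLFrame X _≼_ _⊏_ (BoolClosure P)
      × (∀ a → a ∈ₛ BoolClosure P → Box _⊏_ a ∈ₛ P)
lemma4p5 lem X _≼_ _⊏_ P G =
  record { s4k = s4k ; bhl = compat } , λ _ → Box-BoolClosure∈P _⊏_ closed-⇝
  where
  open IsGeneralSqFrame G
  open ClauseMeets lem P has-full has-empty closed-∩ closed-∪

  s4k : IsGeneralS4KFrame X _≼_ _⊏_ (BoolClosure P)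
  s4k = record
    { preorder   = IsPartialOrder.isPreorder partialOrder
    ; has-full   = ∈ₛ-intro full
    ; has-empty  = ∈ₛ-intro empty
    ; closed-∁   = λ _ → ∈ₛ-map₁ ∁ₛ ∁-cong (∈ₛ-intro ∘ compl)
    ; closed-∩   = λ _ _ → ∈ₛ-map₂ _∩ₛ_ ∩-cong λ bc bd → ∈ₛ-intro (inter bc bd)
    ; closed-∪   = λ _ _ → ∈ₛ-map₂ _∪ₛ_ ∪-cong λ bc bd → ∈ₛ-intro (union bc bd)
    ; closed-[i] = λ _ → ∈ₛ-mono base ∘ Box-BoolClosure∈P _≼_ closed-→
    ; closed-[m] = λ _ → ∈ₛ-mono base ∘ Box-BoolClosure∈P _⊏_ closed-⇝
    }
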